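{- Let $G$ be a finite-dimensional $\mathbb{F}_p$-vector space and let $W, U_1, U_2, V_1, V_2 \leq G$ be subspaces of dimension $d$. Let $K \geq 1$ be such that $|W \cap (U_1 + U_2 + V_1 + V_2)| \leq K$. Suppose that $\phi_i \colon \mathbb{F}_p^d \to U_i$ ($i \in \{1,2\}$), $\psi_i \colon \mathbb{F}_p^d \to V_i$ ($i \in \{1,2\}$) and $\theta \colon \mathbb{F}_p^d \to W$ are linear maps such that $\operatorname{rank} (\phi_1 + \phi_2 + \psi_1 + \psi_2 + \theta) \leq r$ (as maps $\mathbb{F}_p^d\to G$). Then $\operatorname{rank} \theta \leq r + \log_p K$. -}

module Defs where

open import Data.Nat using (ℕ; zero; suc; NonZero)
import Data.Nat as ℕ
open import Data.Nat.DivMod using (_mod_)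
open import Data.Fin using (Fin; toℕ)
import Data.Fin as Fin
open import Data.Vec using (Vec; zipWith; map; replicate)
open import Data.List using (List; length)
open import Data.List.Membership.Propositional using (_∈_)
open import Data.Product using (Σ; ∃; ∃-syntax; _×_; _,_)
open import Relation.Binary.PropositionalEquality using (_≡_)
open import Function using (_∘_)

-- Everything is parameterised by the characteristic p (assumed prime in
-- the statement); 𝔽ₚ is modelled as Fin p with arithmetic modulo p.
module _ (p : ℕ) .{{_ : NonZero p}} where

  𝔽 : Set
  𝔽 = Fin p

  0𝔽 : 𝔽
  0𝔽 = 0 mod p

  _+𝔽_ : 𝔽 → 𝔽 → 𝔽
  a +𝔽 b = (toℕ a ℕ.+ toℕ b) mod p

  _*𝔽_ : 𝔽 → 𝔽 → 𝔽
  a *𝔽 b = (toℕ a ℕ.* toℕ b) mod p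

  Vect : ℕ → Set
  Vect n = Vec 𝔽 n

  0V : ∀ {n} → Vect n
  0V {n} = replicate n 0𝔽

  _+V_ : ∀ {n} → Vect n → Vect n → Vect n
  _+V_ = zipWith _+𝔽_

  _·V_ : ∀ {n} → 𝔽 → Vect n → Vect n
  c ·V v = map (c *𝔽_) v

  VPred : ℕ → Set₁
  VPred n = Vect n → Set

  record Subspace (n : ℕ) : Set₁ where
    field
      mem  : VPred n
      0∈   : mem 0V
      +∈   : ∀ {u v} → mem u → mem v → mem (u +V v)
      ·∈   : ∀ c {v} → mem v → mem (c ·V v)
  open Subspace public

  lincomb : ∀ {k n} → (Fin k → Vect n) → (Fin k → 𝔽) → Vect n
  lincomb {zero}  b c = 0V
  lincomb {suc k} b c = (c Fin.zero ·V b Fin.zero) +V lincomb (b ∘ Fin.suc) (c ∘ Fin.suc)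

  LinIndep : ∀ {k n} → (Fin k → Vect n) → Set
  LinIndep b = ∀ c → lincomb b c ≡ 0V → ∀ j → c j ≡ 0𝔽

  SpansOf : ∀ {k n} → VPred n → (Fin k → Vect n) → Set
  SpansOf S b = (∀ j → S (b j)) × (∀ v → S v → ∃[ c ] lincomb b c ≡ v)

  HasDim : ∀ {n} → VPred n → ℕ → Set
  HasDim {n} S k = Σ (Fin k → Vect n) λ b → LinIndep b × SpansOf S b

  record LinMap (d n : ℕ) : Set where
    field
      fun  : Vect d → Vect n
      +hom : ∀ u v → fun (u +V v) ≡ fun u +V fun v
      ·hom : ∀ c v → fun (c ·V v) ≡ c ·V fun v
  open LinMap public

  MapsInto : ∀ {d n} → LinMap d n → Subspace n → Set
  MapsInto f S = ∀ x → mem S (fun f x)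

  Image : ∀ {d n} → (Vect d → Vect n) → VPred n
  Image f v = ∃[ x ] f x ≡ v

  _⊕_ : ∀ {n} → VPred n → VPred n → VPred n
  (S ⊕ T) v = ∃[ a ] ∃[ b ] (S a × T b × a +V b ≡ v)

  _∩_ : ∀ {n} → VPred n → VPred n → VPred n
  (S ∩ T) v = S v × T v

  -- |S| ≤ K : S is covered by a list of at most K vectors
  CardAtMost : ∀ {n} → ℕ → VPred n → Set
  CardAtMost {n} K S = Σ (List (Vect n)) λ xs → length xs ℕ.≤ K × (∀ v → S v → v ∈ xs)

  sum5 : ∀ {d n} → (f₁ f₂ f₃ f₄ f₅ : LinMap d n) → Vect d → Vect n
  sum5 f₁ f₂ f₃ f₄ f₅ x = (((fun f₁ x +V fun f₂ x) +V fun f₃ x) +V fun f₄ x) +V fun f₅ x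

-- On the kernel of S = φ₁ + φ₂ + ψ₁ + ψ₂ + θ we have θ z = (φ₁ + φ₂ + ψ₁ + ψ₂)(-z),
-- so θ maps ker S into W ∩ (U₁ + U₂ + V₁ + V₂), a set of at most K vectors.
-- Write θ x = Σ cⱼ bⱼ over a basis b of im θ. The coordinates of S x in a basis
-- of im S (p^r choices) lift to some y with S y = S x, so x - y ∈ ker S, and
-- θ x = θ (x - y) + θ y is determined by those coordinates and by θ (x - y).
-- Hence c ↦ (coordinates, θ (x - y)) is injective and p^(rank θ) ≤ p^r K.
module Submission where

open import Defs
open import Data.Nat using (ℕ; NonZero; _≤_; _^_; _*_)
open import Data.Nat.Primality using (Prime)
open import Data.Product using (∃-syntax; _×_; _,_; proj₁; proj₂)

open import Algebra.Bundles using (AbelianGroup)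
open import Algebra.Consequences.Propositional
  using (comm∧idˡ⇒id; comm∧invʳ⇒inv; comm∧assoc⇒middleFour; comm∧distrʳ⇒distrˡ)
open import Algebra.Structures using (IsAbelianGroup)
import Algebra.Properties.AbelianGroup as AbelianGroupProperties
open import Data.Fin using (Fin; toℕ; combine; finToFun; funToFin)
open import Data.Fin.Properties
  using (toℕ-injective; toℕ-fromℕ<; toℕ<n; combine-injective; funToFin-finToFin; finToFun-funToFin; injective⇒≤)
open import Data.List using (length; lookup)
open import Data.List.Relation.Unary.Any using (index)
open import Data.List.Relation.Unary.Any.Properties using (lookup-index)
import Data.Nat as ℕ
open import Data.Nat.DivMod using (_mod_; _%_; m%n<n; m<n⇒m%n≡m; %-distribˡ-+; %-distribˡ-*; m*n%n≡0; %-congˡ)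
import Data.Nat.Properties as ℕ
open import Data.Vec using ([]; _∷_; zipWith; map; replicate)
open import Data.Vec.Properties
  using (zipWith-assoc; zipWith-identityˡ; zipWith-identityʳ; zipWith-inverseˡ; zipWith-inverseʳ; zipWith-comm; map-replicate)
open import Function using (_∘_)
open import Level using (0ℓ)
open import Relation.Binary.PropositionalEquality

zipWith-isAbelianGroup : ∀ {a} {A : Set a} {_∙_ : A → A → A} {ε : A} {_⁻¹ : A → A} {n : ℕ}
  → IsAbelianGroup _≡_ _∙_ ε _⁻¹ → IsAbelianGroup _≡_ (zipWith {n = n} _∙_) (replicate n ε) (map _⁻¹)
zipWith-isAbelianGroup G = record
  { isGroup = record
    { isMonoid = record
      { isSemigroup = record
        { isMagma = record { isEquivalence = isEquivalence ; ∙-cong = cong₂ _ }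
        ; assoc = zipWith-assoc assoc }
      ; identity = zipWith-identityˡ identityˡ , zipWith-identityʳ identityʳ }
    ; inverse = zipWith-inverseˡ inverseˡ , zipWith-inverseʳ inverseʳ
    ; ⁻¹-cong = cong (map _) }
  ; comm = zipWith-comm comm }
  where open IsAbelianGroup G using (assoc; identityˡ; identityʳ; inverseˡ; inverseʳ; comm)

funToFin-cong : ∀ {m n} {f g : Fin m → Fin n} → (∀ i → f i ≡ g i) → funToFin f ≡ funToFin g
funToFin-cong {ℕ.zero}  f≗g = refl
funToFin-cong {ℕ.suc m} f≗g = cong₂ combine (f≗g Fin.zero) (funToFin-cong (f≗g ∘ Fin.suc))

^-≤-byInjection : ∀ {m k r l} (g : (Fin k → Fin m) → Fin r → Fin m) (h : (Fin k → Fin m) → Fin l)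
  → (∀ c c′ → (∀ i → g c i ≡ g c′ i) → h c ≡ h c′ → ∀ j → c j ≡ c′ j)
  → m ^ k ≤ m ^ r * l
^-≤-byInjection {m} {k} {r} {l} g h injective = injective⇒≤ {f = encode} encode-injective
  where
  tuple : Fin (m ^ k) → Fin k → Fin m
  tuple = finToFun

  encode : Fin (m ^ k) → Fin (m ^ r * l)
  encode i = combine (funToFin (g (tuple i))) (h (tuple i))

  encode-injective : ∀ {i j} → encode i ≡ encode j → i ≡ j
  encode-injective {i} {j} eq = begin
    i                   ≡⟨ funToFin-finToFin {k} i ⟨
    funToFin (tuple i)  ≡⟨ funToFin-cong (injective _ _ g≗ h≡) ⟩
    funToFin (tuple j)  ≡⟨ funToFin-finToFin {k} j ⟩
    j                   ∎
    where
    open ≡-Reasoning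
    g≡ : funToFin (g (tuple i)) ≡ funToFin (g (tuple j))
    g≡ = proj₁ (combine-injective _ (h (tuple i)) _ (h (tuple j)) eq)
    h≡ : h (tuple i) ≡ h (tuple j)
    h≡ = proj₂ (combine-injective (funToFin (g (tuple i))) _ (funToFin (g (tuple j))) _ eq)
    g≗ : ∀ x → g (tuple i) x ≡ g (tuple j) x
    g≗ x = begin
      g (tuple i) x                        ≡⟨ finToFun-funToFin (g (tuple i)) x ⟨
      finToFun (funToFin (g (tuple i))) x  ≡⟨ cong (λ t → finToFun t x) g≡ ⟩
      finToFun (funToFin (g (tuple j))) x  ≡⟨ finToFun-funToFin (g (tuple j)) x ⟩
      g (tuple j) x                        ∎

module ModularLinearAlgebra (p : ℕ) .{{_ : NonZero p}} where

  open ≡-Reasoning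

  infixl 5 _+ₚ_
  infixl 6 _*ₚ_
  infix 8 -ₚ_

  _+ₚ_ _*ₚ_ : 𝔽 p → 𝔽 p → 𝔽 p
  _+ₚ_ = _+𝔽_ p
  _*ₚ_ = _*𝔽_ p

  0ₚ -1ₚ : 𝔽 p
  0ₚ = 0𝔽 p
  -1ₚ = ℕ.pred p mod p

  -ₚ_ : 𝔽 p → 𝔽 p
  -ₚ a = -1ₚ *ₚ a

  toℕ-mod : ∀ m → toℕ (m mod p) ≡ m % p
  toℕ-mod m = toℕ-fromℕ< (m%n<n m p)

  mod-cong : ∀ {m n} → m % p ≡ n % p → m mod p ≡ n mod p
  mod-cong {m} {n} eq = toℕ-injective (trans (toℕ-mod m) (trans eq (sym (toℕ-mod n))))

  mod-toℕ : ∀ a → toℕ a mod p ≡ a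
  mod-toℕ a = toℕ-injective (trans (toℕ-mod (toℕ a)) (m<n⇒m%n≡m (toℕ<n a)))

  mod-+ : ∀ m n → m mod p +ₚ n mod p ≡ (m ℕ.+ n) mod p
  mod-+ m n = mod-cong (begin
    (toℕ (m mod p) ℕ.+ toℕ (n mod p)) % p  ≡⟨ cong₂ (λ x y → (x ℕ.+ y) % p) (toℕ-mod m) (toℕ-mod n) ⟩
    (m % p ℕ.+ n % p) % p                  ≡⟨ %-distribˡ-+ m n p ⟨
    (m ℕ.+ n) % p                          ∎)

  mod-* : ∀ m n → m mod p *ₚ n mod p ≡ (m ℕ.* n) mod p
  mod-* m n = mod-cong (begin
    (toℕ (m mod p) ℕ.* toℕ (n mod p)) % p  ≡⟨ cong₂ (λ x y → (x ℕ.* y) % p) (toℕ-mod m) (toℕ-mod n) ⟩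
    (m % p ℕ.* (n % p)) % p                ≡⟨ %-distribˡ-* m n p ⟨
    (m ℕ.* n) % p                          ∎)

  +ₚ-assoc : ∀ a b c → (a +ₚ b) +ₚ c ≡ a +ₚ (b +ₚ c)
  +ₚ-assoc a b c = begin
    (a +ₚ b) +ₚ c               ≡⟨ cong ((a +ₚ b) +ₚ_) (mod-toℕ c) ⟨
    (A ℕ.+ B) mod p +ₚ C mod p  ≡⟨ mod-+ (A ℕ.+ B) C ⟩
    (A ℕ.+ B ℕ.+ C) mod p       ≡⟨ cong (_mod p) (ℕ.+-assoc A B C) ⟩
    (A ℕ.+ (B ℕ.+ C)) mod p     ≡⟨ mod-+ A (B ℕ.+ C) ⟨
    A mod p +ₚ (B ℕ.+ C) mod p  ≡⟨ cong (_+ₚ (b +ₚ c)) (mod-toℕ a) ⟩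
    a +ₚ (b +ₚ c)               ∎
    where A = toℕ a; B = toℕ b; C = toℕ c

  +ₚ-comm : ∀ a b → a +ₚ b ≡ b +ₚ a
  +ₚ-comm a b = cong (_mod p) (ℕ.+-comm (toℕ a) (toℕ b))

  +ₚ-identityˡ : ∀ a → 0ₚ +ₚ a ≡ a
  +ₚ-identityˡ a = begin
    0ₚ +ₚ a            ≡⟨ cong (0ₚ +ₚ_) (mod-toℕ a) ⟨
    0ₚ +ₚ toℕ a mod p  ≡⟨ mod-+ 0 (toℕ a) ⟩
    toℕ a mod p        ≡⟨ mod-toℕ a ⟩
    a                  ∎

  -- -1 is represented by p - 1, so a + (-1) a = p a ≡ 0.
  -ₚ-inverseʳ : ∀ a → a +ₚ -ₚ a ≡ 0ₚ
  -ₚ-inverseʳ a = begin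
    a +ₚ -1ₚ *ₚ a                      ≡⟨ cong (λ x → x +ₚ -1ₚ *ₚ x) (mod-toℕ a) ⟨
    A mod p +ₚ -1ₚ *ₚ A mod p          ≡⟨ cong (A mod p +ₚ_) (mod-* (ℕ.pred p) A) ⟩
    A mod p +ₚ (ℕ.pred p ℕ.* A) mod p  ≡⟨ mod-+ A (ℕ.pred p ℕ.* A) ⟩
    (ℕ.suc (ℕ.pred p) ℕ.* A) mod p     ≡⟨ cong (λ q → (q ℕ.* A) mod p) (ℕ.suc-pred p) ⟩
    (p ℕ.* A) mod p                    ≡⟨ mod-cong p*A%p≡0%p ⟩
    0ₚ                                 ∎
    where
    A = toℕ a
    p*A%p≡0%p : (p ℕ.* A) % p ≡ 0 % p
    p*A%p≡0%p = begin
      (p ℕ.* A) % p  ≡⟨ %-congˡ (ℕ.*-comm p A) ⟩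
      (A ℕ.* p) % p  ≡⟨ m*n%n≡0 A p ⟩
      0              ≡⟨ m*n%n≡0 0 p ⟨
      0 % p          ∎

  *ₚ-assoc : ∀ a b c → (a *ₚ b) *ₚ c ≡ a *ₚ (b *ₚ c)
  *ₚ-assoc a b c = begin
    (a *ₚ b) *ₚ c               ≡⟨ cong ((a *ₚ b) *ₚ_) (mod-toℕ c) ⟨
    (A ℕ.* B) mod p *ₚ C mod p  ≡⟨ mod-* (A ℕ.* B) C ⟩
    (A ℕ.* B ℕ.* C) mod p       ≡⟨ cong (_mod p) (ℕ.*-assoc A B C) ⟩
    (A ℕ.* (B ℕ.* C)) mod p     ≡⟨ mod-* A (B ℕ.* C) ⟨
    A mod p *ₚ (B ℕ.* C) mod p  ≡⟨ cong (_*ₚ (b *ₚ c)) (mod-toℕ a) ⟩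
    a *ₚ (b *ₚ c)               ∎
    where A = toℕ a; B = toℕ b; C = toℕ c

  *ₚ-distribʳ : ∀ c a b → (a +ₚ b) *ₚ c ≡ a *ₚ c +ₚ b *ₚ c
  *ₚ-distribʳ c a b = begin
    (a +ₚ b) *ₚ c                             ≡⟨ cong ((a +ₚ b) *ₚ_) (mod-toℕ c) ⟨
    (A ℕ.+ B) mod p *ₚ C mod p                ≡⟨ mod-* (A ℕ.+ B) C ⟩
    ((A ℕ.+ B) ℕ.* C) mod p                   ≡⟨ cong (_mod p) (ℕ.*-distribʳ-+ C A B) ⟩
    (A ℕ.* C ℕ.+ B ℕ.* C) mod p               ≡⟨ mod-+ (A ℕ.* C) (B ℕ.* C) ⟨
    (A ℕ.* C) mod p +ₚ (B ℕ.* C) mod p        ≡⟨ cong₂ _+ₚ_ (mod-* A C) (mod-* B C) ⟨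
    A mod p *ₚ C mod p +ₚ B mod p *ₚ C mod p  ≡⟨ cong₂ (λ x y → x *ₚ C mod p +ₚ y *ₚ C mod p) (mod-toℕ a) (mod-toℕ b) ⟩
    a *ₚ C mod p +ₚ b *ₚ C mod p              ≡⟨ cong (λ z → a *ₚ z +ₚ b *ₚ z) (mod-toℕ c) ⟩
    a *ₚ c +ₚ b *ₚ c                          ∎
    where A = toℕ a; B = toℕ b; C = toℕ c

  *ₚ-comm : ∀ a b → a *ₚ b ≡ b *ₚ a
  *ₚ-comm a b = cong (_mod p) (ℕ.*-comm (toℕ a) (toℕ b))

  *ₚ-zeroʳ : ∀ a → a *ₚ 0ₚ ≡ 0ₚ
  *ₚ-zeroʳ a = begin
    a *ₚ 0ₚ              ≡⟨ cong (_*ₚ 0ₚ) (mod-toℕ a) ⟨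
    toℕ a mod p *ₚ 0ₚ    ≡⟨ mod-* (toℕ a) 0 ⟩
    (toℕ a ℕ.* 0) mod p  ≡⟨ cong (_mod p) (ℕ.*-zeroʳ (toℕ a)) ⟩
    0ₚ                   ∎

  +ₚ-isAbelianGroup : IsAbelianGroup _≡_ _+ₚ_ 0ₚ -ₚ_
  +ₚ-isAbelianGroup = record
    { isGroup = record
      { isMonoid = record
        { isSemigroup = record
          { isMagma = record { isEquivalence = isEquivalence ; ∙-cong = cong₂ _+ₚ_ }
          ; assoc = +ₚ-assoc }
        ; identity = comm∧idˡ⇒id +ₚ-comm +ₚ-identityˡ }
      ; inverse = comm∧invʳ⇒inv +ₚ-comm -ₚ-inverseʳ
      ; ⁻¹-cong = cong -ₚ_ }
    ; comm = +ₚ-comm }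

  +ₚ-abelianGroup : AbelianGroup 0ℓ 0ℓ
  +ₚ-abelianGroup = record { isAbelianGroup = +ₚ-isAbelianGroup }

  module +ₚ = AbelianGroupProperties +ₚ-abelianGroup

  *ₚ-distribˡ : ∀ a b c → a *ₚ (b +ₚ c) ≡ a *ₚ b +ₚ a *ₚ c
  *ₚ-distribˡ = comm∧distrʳ⇒distrˡ *ₚ-comm *ₚ-distribʳ

  infixl 5 _+ᵥ_
  infixr 6 _·ᵥ_
  infix 8 -ᵥ_

  _+ᵥ_ : ∀ {n} → Vect p n → Vect p n → Vect p n
  _+ᵥ_ = _+V_ p

  _·ᵥ_ : ∀ {n} → 𝔽 p → Vect p n → Vect p n
  _·ᵥ_ = _·V_ p

  0ᵥ : ∀ {n} → Vect p n
  0ᵥ = 0V p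

  -ᵥ_ : ∀ {n} → Vect p n → Vect p n
  -ᵥ v = -1ₚ ·ᵥ v

  +ᵥ-abelianGroup : ℕ → AbelianGroup 0ℓ 0ℓ
  +ᵥ-abelianGroup n = record
    { Carrier = Vect p n ; _≈_ = _≡_ ; _∙_ = _+ᵥ_ ; ε = 0ᵥ ; _⁻¹ = -ᵥ_
    ; isAbelianGroup = zipWith-isAbelianGroup +ₚ-isAbelianGroup }

  module +ᵥ {n : ℕ} where
    open AbelianGroup (+ᵥ-abelianGroup n) public using (identityˡ; inverseʳ; assoc; comm)
    open AbelianGroupProperties (+ᵥ-abelianGroup n) public

  +ᵥ-middleFour : ∀ {n} (u v w x : Vect p n) → (u +ᵥ v) +ᵥ (w +ᵥ x) ≡ (u +ᵥ w) +ᵥ (v +ᵥ x)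
  +ᵥ-middleFour = comm∧assoc⇒middleFour +ᵥ.comm +ᵥ.assoc

  ·ᵥ-distribˡ : ∀ {n} a (u v : Vect p n) → a ·ᵥ (u +ᵥ v) ≡ a ·ᵥ u +ᵥ a ·ᵥ v
  ·ᵥ-distribˡ a []      []      = refl
  ·ᵥ-distribˡ a (x ∷ u) (y ∷ v) = cong₂ _∷_ (*ₚ-distribˡ a x y) (·ᵥ-distribˡ a u v)

  ·ᵥ-distribʳ : ∀ {n} a b (v : Vect p n) → (a +ₚ b) ·ᵥ v ≡ a ·ᵥ v +ᵥ b ·ᵥ v
  ·ᵥ-distribʳ a b []      = refl
  ·ᵥ-distribʳ a b (x ∷ v) = cong₂ _∷_ (*ₚ-distribʳ x a b) (·ᵥ-distribʳ a b v)

  ·ᵥ-assoc : ∀ {n} a b (v : Vect p n) → (a *ₚ b) ·ᵥ v ≡ a ·ᵥ b ·ᵥ v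
  ·ᵥ-assoc a b []      = refl
  ·ᵥ-assoc a b (x ∷ v) = cong₂ _∷_ (*ₚ-assoc a b x) (·ᵥ-assoc a b v)

  ·ᵥ-zeroʳ : ∀ {n} a → a ·ᵥ 0ᵥ {n} ≡ 0ᵥ
  ·ᵥ-zeroʳ {n} a = trans (map-replicate (a *ₚ_) 0ₚ n) (cong (replicate n) (*ₚ-zeroʳ a))

  lincomb-cong : ∀ {k n} {b b′ : Fin k → Vect p n} {c c′ : Fin k → 𝔽 p}
    → (∀ j → b j ≡ b′ j) → (∀ j → c j ≡ c′ j) → lincomb p b c ≡ lincomb p b′ c′
  lincomb-cong {ℕ.zero}  b≗ c≗ = refl
  lincomb-cong {ℕ.suc k} b≗ c≗ =
    cong₂ _+ᵥ_ (cong₂ _·ᵥ_ (c≗ Fin.zero) (b≗ Fin.zero)) (lincomb-cong (b≗ ∘ Fin.suc) (c≗ ∘ Fin.suc))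

  lincomb-+ : ∀ {k n} (b : Fin k → Vect p n) (c c′ : Fin k → 𝔽 p)
    → lincomb p b (λ j → c j +ₚ c′ j) ≡ lincomb p b c +ᵥ lincomb p b c′
  lincomb-+ {ℕ.zero}  b c c′ = sym (+ᵥ.identityˡ 0ᵥ)
  lincomb-+ {ℕ.suc k} b c c′ = begin
    (c₀ +ₚ c′₀) ·ᵥ b₀ +ᵥ lincomb p (b ∘ Fin.suc) (λ j → c (Fin.suc j) +ₚ c′ (Fin.suc j))
      ≡⟨ cong₂ _+ᵥ_ (·ᵥ-distribʳ c₀ c′₀ b₀) (lincomb-+ (b ∘ Fin.suc) (c ∘ Fin.suc) (c′ ∘ Fin.suc)) ⟩
    (c₀ ·ᵥ b₀ +ᵥ c′₀ ·ᵥ b₀) +ᵥ (lincomb p (b ∘ Fin.suc) (c ∘ Fin.suc) +ᵥ lincomb p (b ∘ Fin.suc) (c′ ∘ Fin.suc))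
      ≡⟨ +ᵥ-middleFour _ _ _ _ ⟩
    lincomb p b c +ᵥ lincomb p b c′ ∎
    where c₀ = c Fin.zero; c′₀ = c′ Fin.zero; b₀ = b Fin.zero

  lincomb-* : ∀ {k n} (b : Fin k → Vect p n) a (c : Fin k → 𝔽 p)
    → lincomb p b (λ j → a *ₚ c j) ≡ a ·ᵥ lincomb p b c
  lincomb-* {ℕ.zero}  b a c = sym (·ᵥ-zeroʳ a)
  lincomb-* {ℕ.suc k} b a c = begin
    (a *ₚ c Fin.zero) ·ᵥ b Fin.zero +ᵥ lincomb p (b ∘ Fin.suc) (λ j → a *ₚ c (Fin.suc j))
      ≡⟨ cong₂ _+ᵥ_ (·ᵥ-assoc a (c Fin.zero) (b Fin.zero)) (lincomb-* (b ∘ Fin.suc) a (c ∘ Fin.suc)) ⟩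
    a ·ᵥ c Fin.zero ·ᵥ b Fin.zero +ᵥ a ·ᵥ lincomb p (b ∘ Fin.suc) (c ∘ Fin.suc)
      ≡⟨ ·ᵥ-distribˡ a _ _ ⟨
    a ·ᵥ lincomb p b c ∎

  lincomb-injective : ∀ {k n} {b : Fin k → Vect p n} {c c′ : Fin k → 𝔽 p}
    → LinIndep p b → lincomb p b c ≡ lincomb p b c′ → ∀ j → c j ≡ c′ j
  lincomb-injective {b = b} {c} {c′} b-indep eq j =
    +ₚ.x∙y⁻¹≈ε⇒x≈y (c j) (c′ j) (b-indep (λ i → c i +ₚ -ₚ c′ i) difference≡0 j)
    where
    difference≡0 : lincomb p b (λ i → c i +ₚ -ₚ c′ i) ≡ 0ᵥ
    difference≡0 = begin
      lincomb p b (λ i → c i +ₚ -ₚ c′ i)            ≡⟨ lincomb-+ b c (λ i → -ₚ c′ i) ⟩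
      lincomb p b c +ᵥ lincomb p b (λ i → -ₚ c′ i)  ≡⟨ cong₂ _+ᵥ_ eq (lincomb-* b -1ₚ c′) ⟩
      lincomb p b c′ +ᵥ -ᵥ lincomb p b c′           ≡⟨ +ᵥ.inverseʳ _ ⟩
      0ᵥ                                            ∎

  module _ {d n : ℕ} where

    fun-0ᵥ : (f : LinMap p d n) → fun f 0ᵥ ≡ 0ᵥ
    fun-0ᵥ f = +ᵥ.identityˡ-unique (fun f 0ᵥ) (fun f 0ᵥ)
      (trans (sym (+hom f 0ᵥ 0ᵥ)) (cong (fun f) (+ᵥ.identityˡ 0ᵥ)))

    fun-sub : (f : LinMap p d n) (u v : Vect p d) → fun f (u +ᵥ -ᵥ v) ≡ fun f u +ᵥ -ᵥ fun f v
    fun-sub f u v = trans (+hom f u (-ᵥ v)) (cong (fun f u +ᵥ_) (·hom f -1ₚ v))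

    fun-lincomb : ∀ {k} (f : LinMap p d n) (b : Fin k → Vect p d) c
      → fun f (lincomb p b c) ≡ lincomb p (fun f ∘ b) c
    fun-lincomb {ℕ.zero}  f b c = fun-0ᵥ f
    fun-lincomb {ℕ.suc k} f b c = begin
      fun f (c Fin.zero ·ᵥ b Fin.zero +ᵥ lincomb p (b ∘ Fin.suc) (c ∘ Fin.suc))
        ≡⟨ +hom f _ _ ⟩
      fun f (c Fin.zero ·ᵥ b Fin.zero) +ᵥ fun f (lincomb p (b ∘ Fin.suc) (c ∘ Fin.suc))
        ≡⟨ cong₂ _+ᵥ_ (·hom f (c Fin.zero) (b Fin.zero)) (fun-lincomb f (b ∘ Fin.suc) (c ∘ Fin.suc)) ⟩
      lincomb p (fun f ∘ b) c ∎

    fun-lincomb-preimages : ∀ {k} (f : LinMap p d n) {b : Fin k → Vect p n}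
      (b∈ : ∀ j → Image p (fun f) (b j)) c → fun f (lincomb p (proj₁ ∘ b∈) c) ≡ lincomb p b c
    fun-lincomb-preimages f b∈ c = trans (fun-lincomb f (proj₁ ∘ b∈) c) (lincomb-cong (proj₂ ∘ b∈) (λ _ → refl))

    infixl 5 _+ₗ_

    _+ₗ_ : LinMap p d n → LinMap p d n → LinMap p d n
    f +ₗ g = record
      { fun  = λ x → fun f x +ᵥ fun g x
      ; +hom = λ u v → trans (cong₂ _+ᵥ_ (+hom f u v) (+hom g u v)) (+ᵥ-middleFour _ _ _ _)
      ; ·hom = λ a v → trans (cong₂ _+ᵥ_ (·hom f a v) (·hom g a v)) (sym (·ᵥ-distribˡ a _ _)) }

    +ₗ-into : ∀ {P Q : VPred p n} (f g : LinMap p d n)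
      → (∀ x → P (fun f x)) → (∀ x → Q (fun g x)) → ∀ x → _⊕_ p P Q (fun (f +ₗ g) x)
    +ₗ-into f g f∈ g∈ x = fun f x , fun g x , f∈ x , g∈ x , refl

    ker-+ₗ : ∀ (f g : LinMap p d n) {z} → fun (f +ₗ g) z ≡ 0ᵥ → fun g z ≡ fun f (-ᵥ z)
    ker-+ₗ f g {z} eq = trans (+ᵥ.inverseʳ-unique (fun f z) (fun g z) eq) (sym (·hom f -1ₚ z))

    rank-≤-byKernel : ∀ {r k K} (S θ : LinMap p d n) {P : VPred p n}
      → HasDim p (Image p (fun S)) r → HasDim p (Image p (fun θ)) k
      → (∀ z → fun S z ≡ 0ᵥ → P (fun θ z)) → CardAtMost p K P
      → p ^ k ≤ p ^ r * K
    rank-≤-byKernel {r} {k} S θ (e , _ , e∈ , e-spans) (b , b-indep , b∈ , _) ker⇒P (L , |L|≤K , L-covers) =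
      ℕ.≤-trans (^-≤-byInjection coords position injective) (ℕ.*-monoʳ-≤ (p ^ r) |L|≤K)
      where
      preimage : (Fin k → 𝔽 p) → Vect p d
      preimage = lincomb p (proj₁ ∘ b∈)

      coords : (Fin k → 𝔽 p) → Fin r → 𝔽 p
      coords c = proj₁ (e-spans (fun S (preimage c)) (preimage c , refl))

      lift : (Fin r → 𝔽 p) → Vect p d
      lift = lincomb p (proj₁ ∘ e∈)

      kernelPart : (Fin k → 𝔽 p) → Vect p d
      kernelPart c = preimage c +ᵥ -ᵥ lift (coords c)

      S-lift : ∀ c → fun S (lift (coords c)) ≡ fun S (preimage c)
      S-lift c = trans (fun-lincomb-preimages S e∈ (coords c)) (proj₂ (e-spans _ (preimage c , refl)))

      S-kernelPart : ∀ c → fun S (kernelPart c) ≡ 0ᵥ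
      S-kernelPart c = trans (fun-sub S (preimage c) (lift (coords c))) (+ᵥ.x≈y⇒x∙y⁻¹≈ε (sym (S-lift c)))

      position : (Fin k → 𝔽 p) → Fin (length L)
      position c = index (L-covers (fun θ (kernelPart c)) (ker⇒P (kernelPart c) (S-kernelPart c)))

      θ-decompose : ∀ c → lincomb p b c ≡ fun θ (kernelPart c) +ᵥ fun θ (lift (coords c))
      θ-decompose c = begin
        lincomb p b c                                    ≡⟨ fun-lincomb-preimages θ b∈ c ⟨
        fun θ (preimage c)                               ≡⟨ cong (fun θ) (+ᵥ.//-rightDividesˡ (lift (coords c)) (preimage c)) ⟨
        fun θ (kernelPart c +ᵥ lift (coords c))          ≡⟨ +hom θ _ _ ⟩
        fun θ (kernelPart c) +ᵥ fun θ (lift (coords c))  ∎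

      injective : ∀ c c′ → (∀ i → coords c i ≡ coords c′ i) → position c ≡ position c′ → ∀ j → c j ≡ c′ j
      injective c c′ coords≗ position≡ = lincomb-injective b-indep (begin
        lincomb p b c                                      ≡⟨ θ-decompose c ⟩
        fun θ (kernelPart c) +ᵥ fun θ (lift (coords c))    ≡⟨ cong₂ _+ᵥ_ θ-kernelPart≡ (cong (fun θ) (lincomb-cong (λ _ → refl) coords≗)) ⟩
        fun θ (kernelPart c′) +ᵥ fun θ (lift (coords c′))  ≡⟨ θ-decompose c′ ⟨
        lincomb p b c′                                     ∎)
        where
        θ-kernelPart≡ : fun θ (kernelPart c) ≡ fun θ (kernelPart c′)
        θ-kernelPart≡ = begin
          fun θ (kernelPart c)    ≡⟨ lookup-index (L-covers _ _) ⟩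
          lookup L (position c)   ≡⟨ cong (lookup L) position≡ ⟩
          lookup L (position c′)  ≡⟨ lookup-index (L-covers _ _) ⟨
          fun θ (kernelPart c′)   ∎

lemma4p3 : (p : ℕ) .{{_ : NonZero p}} → Prime p → (n d : ℕ)
    → (W U₁ U₂ V₁ V₂ : Subspace p n)
    → HasDim p (mem W) d → HasDim p (mem U₁) d → HasDim p (mem U₂) d
    → HasDim p (mem V₁) d → HasDim p (mem V₂) d
    → (K : ℕ) → 1 ≤ K
    → CardAtMost p K (_∩_ p (mem W) (_⊕_ p (_⊕_ p (_⊕_ p (mem U₁) (mem U₂)) (mem V₁)) (mem V₂)))
    → (φ₁ φ₂ ψ₁ ψ₂ θ : LinMap p d n)
    → MapsInto p φ₁ U₁ → MapsInto p φ₂ U₂ → MapsInto p ψ₁ V₁ → MapsInto p ψ₂ V₂ → MapsInto p θ W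
    → (r : ℕ)
    → (∃[ k ] (HasDim p (Image p (sum5 p φ₁ φ₂ ψ₁ ψ₂ θ)) k × k ≤ r))
    → (k : ℕ) → HasDim p (Image p (fun θ)) k → p ^ k ≤ p ^ r * K
lemma4p3 p _ n d W U₁ U₂ V₁ V₂ _ _ _ _ _ K _ ∩-small φ₁ φ₂ ψ₁ ψ₂ θ φ₁∈ φ₂∈ ψ₁∈ ψ₂∈ θ∈ r (r′ , dim-im-sum , r′≤r) k dim-im-θ =
  begin
    p ^ k       ≤⟨ rank-≤-byKernel (R +ₗ θ) θ dim-im-sum dim-im-θ θ[ker]⊆W∩ΣUV ∩-small ⟩
    p ^ r′ * K  ≤⟨ ℕ.*-monoˡ-≤ K (ℕ.^-monoʳ-≤ p r′≤r) ⟩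
    p ^ r * K   ∎
  where
  open ModularLinearAlgebra p
  open ℕ.≤-Reasoning

  R : LinMap p d n
  R = φ₁ +ₗ φ₂ +ₗ ψ₁ +ₗ ψ₂

  ΣUV : VPred p n
  ΣUV = _⊕_ p (_⊕_ p (_⊕_ p (mem U₁) (mem U₂)) (mem V₁)) (mem V₂)

  R-into : ∀ x → ΣUV (fun R x)
  R-into = +ₗ-into (φ₁ +ₗ φ₂ +ₗ ψ₁) ψ₂ (+ₗ-into (φ₁ +ₗ φ₂) ψ₁ (+ₗ-into φ₁ φ₂ φ₁∈ φ₂∈) ψ₁∈) ψ₂∈

  θ[ker]⊆W∩ΣUV : ∀ z → fun (R +ₗ θ) z ≡ 0ᵥ → _∩_ p (mem W) ΣUV (fun θ z)
  θ[ker]⊆W∩ΣUV z Sz≡0 = θ∈ z , subst ΣUV (sym (ker-+ₗ R θ Sz≡0)) (R-into (-ᵥ z))
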